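{- If a graph $G$ has four pairwise edge-disjoint cycles $F_1,F_2,F_3,F_4$ such that $F_1$ and $F_2$ share exactly one vertex, $F_3$ and $F_4$ share exactly one vertex, and $F_1\cup F_2$ and $F_3\cup F_4$ are vertex-disjoint, then $d_g(S(G))=1$.
   Context: All graphs are finite and simple. The subdivision graph $S(G)$ is obtained from $G$ by replacing each edge $uv$ by a new vertex adjacent to exactly $u$ and $v$. For a vertex $x$, $N[x]$ denotes its closed neighborhood. The domatic number game on a graph $H$ with palette $[k]=\{1,\dots,k\}$: two players, Alice and Bob, alternately choose a previously unchosen vertex of $H$ and assign it a color from $[k]$, until every vertex has been colored. Let $V_i$ be the set of vertices colored $i$. Alice wins if every $V_i$ ($i\in[k]$) is a dominating set of $H$, i.e. for every vertex $x$ and every color $c\in[k]$ some vertex of $N[x]$ has color $c$; otherwise Bob wins. In the $A$-game Alice moves first. The game domatic number $d_g(H)$ is the largest $k$ for which Alice has a winning strategy in the $A$-game with palette $[k]$. -}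

module Defs where

open import Data.Bool using (Bool; true; false; T; _∧_; if_then_else_)
open import Data.Bool.Properties using (T-irrelevant)
open import Data.Nat using (ℕ; suc; _≤_; _<_; _<ᵇ_)
open import Data.Fin using (Fin; zero; suc; toℕ; inject₁; fromℕ; _≟_)
open import Data.Maybe using (Maybe; just; nothing)
open import Data.Product using (Σ; ∃; ∃-syntax; _×_; _,_)
open import Data.Sum using (_⊎_; inj₁; inj₂)
import Data.Product.Properties as ×P
import Data.Sum.Properties as ⊎P
open import Relation.Binary.Definitions using (DecidableEquality)
open import Relation.Binary.PropositionalEquality using (_≡_)
open import Relation.Nullary using (¬_; yes; no; does)
open import Function.Definitions using (Injective)

record Graph : Set₁ where
  field
    V    : Set
    _≟V_ : DecidableEquality V
    Adj  : V → V → Set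

module _ (H : Graph) where
  open Graph H

  InClosedNbhd : V → V → Set
  InClosedNbhd x y = (y ≡ x) ⊎ Adj x y

  Partial : ℕ → Set
  Partial k = V → Maybe (Fin k)

  update : {k : ℕ} → Partial k → V → Fin k → Partial k
  update p v c w = if does (w ≟V v) then just c else p w

  Complete : {k : ℕ} → Partial k → Set
  Complete p = ∀ v → ∃[ c ] (p v ≡ just c)

  AllClassesDominating : {k : ℕ} → Partial k → Set
  AllClassesDominating p = ∀ x c → ∃[ y ] (InClosedNbhd x y × p y ≡ just c)

  data Player : Set where
    alice bob : Player

  -- Alice has a winning strategy from position p with the given player to move.
  -- (Inductive: the well-founded strategy trees of the finite game.)
  data AliceWinsFrom {k : ℕ} : Partial k → Player → Set where
    finished  : ∀ {p t} → Complete p → AllClassesDominating p → AliceWinsFrom p t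
    aliceMove : ∀ {p} (v : V) (c : Fin k) → p v ≡ nothing →
                AliceWinsFrom (update p v c) bob → AliceWinsFrom p alice
    bobMove   : ∀ {p} → ¬ Complete p →
                (∀ (v : V) (c : Fin k) → p v ≡ nothing → AliceWinsFrom (update p v c) alice) →
                AliceWinsFrom p bob

  AliceWinsAGame : ℕ → Set
  AliceWinsAGame k = AliceWinsFrom {k} (λ _ → nothing) alice

  GameDomaticNumberIs : ℕ → Set
  GameDomaticNumberIs d = AliceWinsAGame d × (∀ k → d < k → ¬ AliceWinsAGame k)

record SimpleGraph : Set where
  field
    n      : ℕ
    adj    : Fin n → Fin n → Bool
    sym    : ∀ u v → adj u v ≡ adj v u
    irrefl : ∀ u → adj u u ≡ false

module _ (G : SimpleGraph) where
  open SimpleGraph G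

  -- an edge uv of G, stored once as an ordered pair with u < v
  Edge : Set
  Edge = Σ (Fin n × Fin n) λ { (u , v) → T ((toℕ u <ᵇ toℕ v) ∧ adj u v) }

  edge≟ : DecidableEquality Edge
  edge≟ = ×P.≡-dec (×P.≡-dec _≟_ _≟_) (λ x y → yes (T-irrelevant x y))

  -- the subdivision graph S(G): original vertices plus one vertex per edge,
  -- the edge vertex of uv adjacent exactly to u and v
  data SubAdj : Fin n ⊎ Edge → Fin n ⊎ Edge → Set where
    vert-edge : ∀ {w} (e : Edge) → let ((u , v) , _) = e in
                (w ≡ u ⊎ w ≡ v) → SubAdj (inj₁ w) (inj₂ e)
    edge-vert : ∀ {w} (e : Edge) → let ((u , v) , _) = e in
                (w ≡ u ⊎ w ≡ v) → SubAdj (inj₂ e) (inj₁ w)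

  S : Graph
  S = record { V = Fin n ⊎ Edge ; _≟V_ = ⊎P.≡-dec _≟_ edge≟ ; Adj = SubAdj }

  -- a cycle of G: distinct vertices x_0,…,x_k (k ≥ 2, length k+1 ≥ 3)
  -- with x_i x_{i+1} and x_k x_0 edges of G
  record Cycle : Set where
    field
      k     : ℕ
      len   : 2 ≤ k
      x     : Fin (suc k) → Fin n
      inj   : Injective _≡_ _≡_ x
      step  : ∀ (i : Fin k) → adj (x (inject₁ i)) (x (suc i)) ≡ true
      close : adj (x (fromℕ k)) (x zero) ≡ true

  OnCycle : Cycle → Fin n → Set
  OnCycle C v = ∃[ i ] (Cycle.x C i ≡ v)

  SamePair : Fin n → Fin n → Fin n → Fin n → Set
  SamePair a b u w = (a ≡ u × b ≡ w) ⊎ (a ≡ w × b ≡ u)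

  CycleEdge : Cycle → Fin n → Fin n → Set
  CycleEdge C u w =
    (∃[ i ] SamePair (Cycle.x C (inject₁ i)) (Cycle.x C (suc i)) u w)
    ⊎ SamePair (Cycle.x C (fromℕ (Cycle.k C))) (Cycle.x C zero) u w

  EdgeDisjoint : Cycle → Cycle → Set
  EdgeDisjoint C D = ∀ u w → CycleEdge C u w → ¬ CycleEdge D u w

  ShareExactlyOneVertex : Cycle → Cycle → Set
  ShareExactlyOneVertex C D =
    ∃[ v ] ((OnCycle C v × OnCycle D v) × (∀ w → OnCycle C w → OnCycle D w → w ≡ v))

{-# OPTIONS --safe #-}
module Submission where

-- With one colour every complete colouring dominates, so Alice wins. With k ≥ 2 colours Bob aims
-- at a subdivision vertex uv with u, v and uv all coloured 0: colour 1 can then never dominate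
-- uv. Alice's first move misses one of the figure eights F₁ ∪ F₂ and F₃ ∪ F₄; Bob colours its
-- centre w with 0, and Alice's answer misses one of its two cycles. Walking round that cycle
-- from w, Bob colours each next vertex with 0. This threatens the subdivision vertex just
-- passed, which Alice must colour at once, and the last vertex threatens two of them together.

open import Defs
open import Data.Bool using (true; _∧_)
open import Data.Bool.Properties using (T-∧; T-≡; T-irrelevant)
open import Data.Empty using (⊥-elim)
open import Data.Fin using (Fin; zero; suc; toℕ; inject₁; fromℕ) renaming (_≟_ to _≟ᶠ_)
open import Data.Fin.Induction using (>-weakInduction)
open import Data.Fin.Properties using (<-cmp; any?; fromℕ≢inject₁; inject₁-injective; suc-injective)
open import Data.List using (List; []; _∷_; [_]; _++_; map; concatMap; cartesianProduct; allFin)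
open import Data.List.Membership.Propositional using (_∈_; _∉_)
open import Data.List.Membership.Propositional.Properties
  using (∈-allFin; ∈-cartesianProduct⁺; ∈-concatMap⁺; ∈-map⁺; ∈-++⁺ˡ; ∈-++⁺ʳ)
open import Data.List.Relation.Unary.All as All using (All; []; _∷_)
open import Data.List.Relation.Unary.All.Properties using (¬Any⇒All¬)
open import Data.List.Relation.Unary.Any as Any using (here; there)
open import Data.List.Relation.Unary.Unique.Propositional using (Unique; []; _∷_)
open import Data.Maybe using (just; nothing)
import Data.Maybe.Properties as Maybe
open import Data.Nat using (ℕ; zero; suc; _<_; _≤_; s≤s; _<ᵇ_)
open import Data.Nat.Properties using (<⇒<ᵇ)
open import Data.Product using (∃-syntax; Σ-syntax; _×_; _,_; proj₁; proj₂)
open import Data.Sum as Sum using (_⊎_; inj₁; inj₂)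
open import Data.Sum.Properties using (inj₁-injective)
open import Function using (_∘_; case_of_)
open import Function.Bundles using (Equivalence)
open import Function.Definitions using (Injective)
open import Relation.Binary.Definitions using (tri<; tri≈; tri>)
open import Relation.Binary.PropositionalEquality using (_≡_; _≢_; refl; sym; trans; cong; ≢-sym)
open import Relation.Nullary using (¬_; Dec; yes; no)
open import Relation.Nullary.Decidable using (T?; _×-dec_; _⊎-dec_)

module _ (H : Graph) where
  open Graph H

  private variable
    k m : ℕ
    p : Partial H k
    a b c e v x y : V
    col col′ : Fin k
    xs : List V

  update-≡ : (p : Partial H k) (v : V) (col : Fin k) → update H p v col v ≡ just col
  update-≡ p v col with v ≟V v
  ... | yes _   = refl
  ... | no v≢v = ⊥-elim (v≢v refl)

  update-≢ : (p : Partial H k) (col : Fin k) → y ≢ v → update H p v col y ≡ p y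
  update-≢ {y = y} {v} p col y≢v with y ≟V v
  ... | yes y≡v = ⊥-elim (y≢v y≡v)
  ... | no _    = refl

  coloured≢uncoloured : (p : Partial H k) → p y ≡ just col → p v ≡ nothing → y ≢ v
  coloured≢uncoloured p py pv refl with () ← trans (sym py) pv

  update-keeps-colour : (p : Partial H k) → p v ≡ nothing → p y ≡ just col′ →
    update H p v col y ≡ just col′
  update-keeps-colour p pv py = trans (update-≢ p _ (coloured≢uncoloured p py pv)) py

  update-keeps-uncoloured : (p : Partial H k) (col : Fin k) → y ≢ v → p y ≡ nothing →
    update H p v col y ≡ nothing
  update-keeps-uncoloured p col y≢v py = trans (update-≢ p col y≢v) py

  uncoloured-before-update : (p : Partial H k) (v : V) (col : Fin k) →
    update H p v col y ≡ nothing → p y ≡ nothing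
  uncoloured-before-update {y = y} p v col py′ with y ≟V v
  ... | yes _ with () ← py′
  ... | no _  = py′

  incomplete : p v ≡ nothing → ¬ Complete H p
  incomplete {v = v} pv complete with () ← trans (sym (proj₂ (complete v))) pv

  no-uncoloured⇒complete : (p : Partial H k) → (∀ v → ¬ p v ≡ nothing) → Complete H p
  no-uncoloured⇒complete p none v with p v in pv
  ... | just col = col , refl
  ... | nothing  = ⊥-elim (none v pv)

  bob-wins-by-move : ∀ v col → p v ≡ nothing →
    ¬ AliceWinsFrom H (update H p v col) alice → ¬ AliceWinsFrom H p bob
  bob-wins-by-move v col pv lost (finished complete _) = incomplete pv complete
  bob-wins-by-move v col pv lost (bobMove _ reply)    = lost (reply v col pv)

  alice-loses-if-every-move-loses : ∃[ v ] p v ≡ nothing →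
    (∀ v col → p v ≡ nothing → ¬ AliceWinsFrom H (update H p v col) bob) →
    ¬ AliceWinsFrom H p alice
  alice-loses-if-every-move-loses (v , pv) _ (finished complete _) = incomplete pv complete
  alice-loses-if-every-move-loses _ lost (aliceMove v col pv next)  = lost v col pv next

  complete⇒dominating₁ : (p : Partial H 1) → Complete H p → AllClassesDominating H p
  complete⇒dominating₁ p complete x zero with complete x
  ... | zero , px = x , inj₁ refl , px

  Doomed : Partial H (suc (suc m)) → Set
  Doomed p = ∃[ x ] (∀ y → InClosedNbhd H x y → p y ≡ just zero)

  doomed⇒¬dominating : {p : Partial H (suc (suc m))} → Doomed p → ¬ AllClassesDominating H p
  doomed⇒¬dominating (x , zeros) dominating with dominating x (suc zero)
  ... | y , y∈N[x] , py with () ← trans (sym (zeros y y∈N[x])) py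

  doomed-update : {p : Partial H (suc (suc m))} → Doomed p → p v ≡ nothing →
    Doomed (update H p v col)
  doomed-update {p = p} (x , zeros) pv = x , λ y y∈N[x] → update-keeps-colour p pv (zeros y y∈N[x])

  Threatened : Partial H (suc (suc m)) → V → Set
  Threatened p x = p x ≡ nothing × (∀ y → Adj x y → p y ≡ just zero)

  Joins : V → V → V → Set
  Joins e a c = ∀ y → Adj e y → y ≡ a ⊎ y ≡ c

  joined⇒threatened : {p : Partial H (suc (suc m))} → Joins e a c →
    p e ≡ nothing → p a ≡ just zero → p c ≡ just zero → Threatened p e
  joined⇒threatened joins pe pa pc =
    pe , λ y e~y → Sum.[ (λ { refl → pa }) , (λ { refl → pc }) ] (joins y e~y)

  -- A ladder from a to b lists c₁ e₁ c₂ e₂ … cₘ eₘ f, where eᵢ joins cᵢ₋₁ and cᵢ (c₀ = a)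
  -- and f joins cₘ and b.
  data Ladder : V → V → List V → Set where
    top  : Joins e a b → Ladder a b [ e ]
    rung : Joins e a c → Ladder c b xs → Ladder a b (c ∷ e ∷ xs)

module Strategies (H : Graph) (vertices : List (Graph.V H)) (∈-vertices : ∀ v → v ∈ vertices)
  where
  open Graph H

  private variable
    k m : ℕ
    t : Player H
    a b x : V
    xs : List V

  complete-or-uncoloured : (p : Partial H k) → Complete H p ⊎ ∃[ v ] p v ≡ nothing
  complete-or-uncoloured p with Any.any? (λ v → Maybe.≡-dec _≟ᶠ_ (p v) nothing) vertices
  ... | yes some = inj₂ (Any.satisfied some)
  ... | no none  = inj₁ (no-uncoloured⇒complete H p λ v pv →
                     none (Any.map (λ { refl → pv }) (∈-vertices v)))

  alice-wins₁-on-her-turn : (L : List V) (p : Partial H 1) →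
    (∀ v → p v ≡ nothing → v ∈ L) → AliceWinsFrom H p alice
  alice-wins₁-on-bobs-turn : (L : List V) (p : Partial H 1) →
    (∀ v → p v ≡ nothing → v ∈ L) → AliceWinsFrom H p bob

  alice-wins₁-on-bobs-turn L p uncoloured∈L with complete-or-uncoloured p
  ... | inj₁ complete = finished complete (complete⇒dominating₁ H p complete)
  ... | inj₂ (_ , pv) = bobMove (incomplete H pv) λ v col _ →
          alice-wins₁-on-her-turn L (update H p v col) λ y p′y →
            uncoloured∈L y (uncoloured-before-update H p v col p′y)

  alice-wins₁-on-her-turn [] p uncoloured∈L = finished complete (complete⇒dominating₁ H p complete)
    where
      complete : Complete H p
      complete = no-uncoloured⇒complete H p λ v pv → case uncoloured∈L v pv of λ ()
  alice-wins₁-on-her-turn (y ∷ L) p uncoloured∈L with p y in py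
  ... | just _  = alice-wins₁-on-her-turn L p λ v pv → drop (uncoloured∈L v pv) pv
    where
      drop : ∀ {v} → v ∈ y ∷ L → p v ≡ nothing → v ∈ L
      drop (here refl) pv with () ← trans (sym py) pv
      drop (there v∈L) _  = v∈L
  ... | nothing = aliceMove y zero py (alice-wins₁-on-bobs-turn L (update H p y zero) λ v p′v →
                    drop v p′v (uncoloured∈L v (uncoloured-before-update H p y zero p′v)))
    where
      drop : ∀ v → update H p y zero v ≡ nothing → v ∈ y ∷ L → v ∈ L
      drop v p′v (here refl) with () ← trans (sym (update-≡ H p y zero)) p′v
      drop v _ (there v∈L) = v∈L

  alice-wins-with-one-colour : AliceWinsAGame H 1
  alice-wins-with-one-colour = alice-wins₁-on-her-turn vertices (λ _ → nothing) λ v _ → ∈-vertices v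

  doomed⇒alice-loses : {p : Partial H (suc (suc m))} → Doomed H p → ¬ AliceWinsFrom H p t
  doomed⇒alice-loses doomed (finished _ dominating) = doomed⇒¬dominating H doomed dominating
  doomed⇒alice-loses doomed (aliceMove v col pv next) =
    doomed⇒alice-loses (doomed-update H doomed pv) next
  doomed⇒alice-loses {p = p} doomed (bobMove incomplete reply) with complete-or-uncoloured p
  ... | inj₁ complete = incomplete complete
  ... | inj₂ (v , pv) = doomed⇒alice-loses (doomed-update H doomed pv) (reply v zero pv)

  threatened⇒bob-wins : {p : Partial H (suc (suc m))} → Threatened H p x →
    ¬ AliceWinsFrom H p bob
  threatened⇒bob-wins {x = x} {p = p} (px , zeros) =
    bob-wins-by-move H x zero px (doomed⇒alice-loses (x , monochrome))
    where
      monochrome : ∀ y → InClosedNbhd H x y → update H p x zero y ≡ just zero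
      monochrome y (inj₁ refl) = update-≡ H p x zero
      monochrome y (inj₂ x~y)  = update-keeps-colour H p px (zeros y x~y)

  -- Colouring c₁ threatens e₁, so Alice must answer on e₁, and the rest is a shorter ladder;
  -- after cₘ both eₘ and f are threatened.
  ladder⇒bob-wins : {p : Partial H (suc (suc m))} → Ladder H a b xs →
    p a ≡ just zero → p b ≡ just zero → All (λ y → p y ≡ nothing) xs → Unique xs →
    ¬ AliceWinsFrom H p bob
  ladder⇒bob-wins (top joins) pa pb (pe ∷ []) _ =
    threatened⇒bob-wins (joined⇒threatened H joins pe pa pb)
  ladder⇒bob-wins {a = a} {b = b} {p = p} (rung {e = e} {c = c} joins ladder) pa pb
                  (pc ∷ pe ∷ pxs) ((c≢e ∷ c≢xs) ∷ e≢xs ∷ unique) =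
    bob-wins-by-move H c zero pc (alice-loses-if-every-move-loses H (e , p₁e) reply)
    where
      p₁ = update H p c zero
      p₁a : p₁ a ≡ just zero
      p₁a = update-keeps-colour H p pc pa
      p₁b : p₁ b ≡ just zero
      p₁b = update-keeps-colour H p pc pb
      p₁c : p₁ c ≡ just zero
      p₁c = update-≡ H p c zero
      p₁e : p₁ e ≡ nothing
      p₁e = update-keeps-uncoloured H p zero (≢-sym c≢e) pe

      reply : ∀ z col → p₁ z ≡ nothing → ¬ AliceWinsFrom H (update H p₁ z col) bob
      reply z col p₁z with z ≟V e
      ... | yes refl = ladder⇒bob-wins ladder
                         (update-keeps-colour H p₁ p₁z p₁c) (update-keeps-colour H p₁ p₁z p₁b)
                         (All.zipWith fresh (pxs , All.zip (c≢xs , e≢xs))) unique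
        where
          fresh : ∀ {y} → p y ≡ nothing × c ≢ y × z ≢ y → update H p₁ z col y ≡ nothing
          fresh (py , c≢y , z≢y) = update-keeps-uncoloured H p₁ col (≢-sym z≢y)
                                     (update-keeps-uncoloured H p zero (≢-sym c≢y) py)
      ... | no z≢e = threatened⇒bob-wins (joined⇒threatened H joins
                       (update-keeps-uncoloured H p₁ col (≢-sym z≢e) p₁e)
                       (update-keeps-colour H p₁ p₁z p₁a) (update-keeps-colour H p₁ p₁z p₁c))

data _↝_ {k : ℕ} : Fin (suc k) → Fin (suc k) → Set where
  next : (i : Fin k) → inject₁ i ↝ suc i
  wrap : fromℕ k ↝ zero

shift : ∀ {k} → Fin (suc k) → Fin (suc k)
shift {k} zero = fromℕ k
shift (suc i)  = inject₁ i

shift-injective : ∀ {k} → Injective _≡_ _≡_ (shift {k})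
shift-injective {x = zero}  {zero}  _  = refl
shift-injective {x = zero}  {suc j} eq = ⊥-elim (fromℕ≢inject₁ eq)
shift-injective {x = suc i} {zero}  eq = ⊥-elim (fromℕ≢inject₁ (sym eq))
shift-injective {x = suc i} {suc j} eq = cong suc (inject₁-injective eq)

shift-↝ : ∀ {k} {i j : Fin (suc k)} → i ↝ j → shift i ↝ shift j
shift-↝ (next zero)    = wrap
shift-↝ (next (suc i)) = next (inject₁ i)
shift-↝ {zero}  wrap   = wrap
shift-↝ {suc k} wrap   = next (fromℕ k)

record Rotation (k : ℕ) : Set where
  field
    rotate      : Fin (suc k) → Fin (suc k)
    injective   : Injective _≡_ _≡_ rotate
    preserves-↝ : ∀ {i j} → i ↝ j → rotate i ↝ rotate j

open Rotation

identity : ∀ {k} → Rotation k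
identity = record { rotate = λ i → i ; injective = λ eq → eq ; preserves-↝ = λ i↝j → i↝j }

shiftAfter : ∀ {k} → Rotation k → Rotation k
shiftAfter ρ = record
  { rotate      = shift ∘ rotate ρ
  ; injective   = injective ρ ∘ shift-injective
  ; preserves-↝ = shift-↝ ∘ preserves-↝ ρ
  }

rotationTo : ∀ {k} (i : Fin (suc k)) → Σ[ ρ ∈ Rotation k ] rotate ρ zero ≡ i
rotationTo = >-weakInduction (λ i → Σ[ ρ ∈ Rotation _ ] rotate ρ zero ≡ i)
  (shiftAfter identity , refl)
  (λ _ (ρ , ρ0≡i+1) → shiftAfter ρ , cong shift ρ0≡i+1)

module _ (G : SimpleGraph) where
  open SimpleGraph G using (n; adj) renaming (sym to adj-sym; irrefl to adj-irrefl)

  private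
    SV : Set
    SV = Graph.V (S G)

  endˡ endʳ : Edge G → Fin n
  endˡ e = proj₁ (proj₁ e)
  endʳ e = proj₂ (proj₁ e)

  edgesOn : Fin n × Fin n → List (Edge G)
  edgesOn (u , v) with T? ((toℕ u <ᵇ toℕ v) ∧ adj u v)
  ... | yes uv = [ (u , v) , uv ]
  ... | no _   = []

  edges : List (Edge G)
  edges = concatMap edgesOn (cartesianProduct (allFin n) (allFin n))

  ∈-edges : ∀ e → e ∈ edges
  ∈-edges ((u , v) , uv) = ∈-concatMap⁺ edgesOn
    (Any.map (λ { refl → ∈-edgesOn }) (∈-cartesianProduct⁺ (∈-allFin u) (∈-allFin v)))
    where
      ∈-edgesOn : ((u , v) , uv) ∈ edgesOn (u , v)
      ∈-edgesOn with T? ((toℕ u <ᵇ toℕ v) ∧ adj u v)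
      ... | yes uv′ = here (cong ((u , v) ,_) (T-irrelevant uv uv′))
      ... | no ¬uv = ⊥-elim (¬uv uv)

  subdivisionVertices : List SV
  subdivisionVertices = map inj₁ (allFin n) ++ map inj₂ edges

  ∈-subdivisionVertices : ∀ s → s ∈ subdivisionVertices
  ∈-subdivisionVertices (inj₁ v) = ∈-++⁺ˡ (∈-map⁺ inj₁ (∈-allFin v))
  ∈-subdivisionVertices (inj₂ e) = ∈-++⁺ʳ (map inj₁ (allFin n)) (∈-map⁺ inj₂ (∈-edges e))

  open Strategies (S G) subdivisionVertices ∈-subdivisionVertices

  samePair-euclid : ∀ {a b a′ b′ u w} →
    SamePair G a b u w → SamePair G a′ b′ u w → SamePair G a b a′ b′
  samePair-euclid (inj₁ (a≡u , b≡w)) (inj₁ (a′≡u , b′≡w)) =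
    inj₁ (trans a≡u (sym a′≡u) , trans b≡w (sym b′≡w))
  samePair-euclid (inj₁ (a≡u , b≡w)) (inj₂ (a′≡w , b′≡u)) =
    inj₂ (trans a≡u (sym b′≡u) , trans b≡w (sym a′≡w))
  samePair-euclid (inj₂ (a≡w , b≡u)) (inj₁ (a′≡u , b′≡w)) =
    inj₂ (trans a≡w (sym b′≡w) , trans b≡u (sym a′≡u))
  samePair-euclid (inj₂ (a≡w , b≡u)) (inj₂ (a′≡w , b′≡u)) =
    inj₁ (trans a≡w (sym a′≡w) , trans b≡u (sym b′≡u))

  edgeBetween : (u v : Fin n) → adj u v ≡ true → Edge G
  edgeBetween u v uv with <-cmp u v
  ... | tri< u<v _ _ = (u , v) , Equivalence.from T-∧ (<⇒<ᵇ u<v , Equivalence.from T-≡ uv)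
  ... | tri≈ _ refl _ with () ← trans (sym uv) (adj-irrefl u)
  ... | tri> _ _ v<u = (v , u) , Equivalence.from T-∧
                                   (<⇒<ᵇ v<u , Equivalence.from T-≡ (trans (adj-sym v u) uv))

  edgeBetween-ends : ∀ u v uv →
    SamePair G u v (endˡ (edgeBetween u v uv)) (endʳ (edgeBetween u v uv))
  edgeBetween-ends u v uv with <-cmp u v
  ... | tri< _ _ _ = inj₁ (refl , refl)
  ... | tri≈ _ refl _ with () ← trans (sym uv) (adj-irrefl u)
  ... | tri> _ _ _ = inj₂ (refl , refl)

  ends⇒joins : ∀ {u v} e → SamePair G u v (endˡ e) (endʳ e) →
    Joins (S G) (inj₂ e) (inj₁ u) (inj₁ v)
  ends⇒joins e (inj₁ (refl , refl)) _ (edge-vert _ end) = Sum.map (cong inj₁) (cong inj₁) end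
  ends⇒joins e (inj₂ (refl , refl)) _ (edge-vert _ end) =
    Sum.swap (Sum.map (cong inj₁) (cong inj₁) end)

  edgeBetween-joins : ∀ u v uv → Joins (S G) (inj₂ (edgeBetween u v uv)) (inj₁ u) (inj₁ v)
  edgeBetween-joins u v uv = ends⇒joins _ (edgeBetween-ends u v uv)

  PartOf : Cycle G → SV → Set
  PartOf C (inj₁ v) = OnCycle G C v
  PartOf C (inj₂ e) = CycleEdge G C (endˡ e) (endʳ e)

  anchor : SV → Fin n
  anchor (inj₁ v) = v
  anchor (inj₂ e) = endˡ e

  cycleEdge⇒onCycle : ∀ C {u w} → CycleEdge G C u w → OnCycle G C u
  cycleEdge⇒onCycle C (inj₁ (i , inj₁ (xi≡u , _))) = inject₁ i , xi≡u
  cycleEdge⇒onCycle C (inj₁ (i , inj₂ (_ , xi+1≡u))) = suc i , xi+1≡u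
  cycleEdge⇒onCycle C (inj₂ (inj₁ (xk≡u , _))) = fromℕ _ , xk≡u
  cycleEdge⇒onCycle C (inj₂ (inj₂ (_ , x0≡u))) = zero , x0≡u

  part⇒anchor-onCycle : ∀ C s → PartOf C s → OnCycle G C (anchor s)
  part⇒anchor-onCycle C (inj₁ v) onC = onC
  part⇒anchor-onCycle C (inj₂ e) onC = cycleEdge⇒onCycle C onC

  onCycle? : ∀ C v → Dec (OnCycle G C v)
  onCycle? C v = any? λ i → Cycle.x C i ≟ᶠ v

  samePair? : ∀ a b u w → Dec (SamePair G a b u w)
  samePair? a b u w = ((a ≟ᶠ u) ×-dec (b ≟ᶠ w)) ⊎-dec ((a ≟ᶠ w) ×-dec (b ≟ᶠ u))

  partOf? : ∀ C s → Dec (PartOf C s)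
  partOf? C (inj₁ v) = onCycle? C v
  partOf? C (inj₂ e) = any? (λ i → samePair? _ _ _ _) ⊎-dec samePair? _ _ _ _

  common-part : ∀ {C D w s} → EdgeDisjoint G C D →
    (∀ v → OnCycle G C v → OnCycle G D v → v ≡ w) → PartOf C s → PartOf D s → s ≡ inj₁ w
  common-part {s = inj₁ v} _ shared onC onD = cong inj₁ (shared v onC onD)
  common-part {s = inj₂ e} disjoint _ onC onD = ⊥-elim (disjoint _ _ onC onD)

  closingEdge : Cycle G → Edge G
  closingEdge C = edgeBetween _ _ (Cycle.close C)

  closingEdge-part : ∀ C → PartOf C (inj₂ (closingEdge C))
  closingEdge-part C = inj₂ (edgeBetween-ends _ _ _)

  module _ (C : Cycle G) where
    open Cycle C using (k; len; x; inj; step; close)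

    adj-↝ : ∀ {i j} → i ↝ j → adj (x i) (x j) ≡ true
    adj-↝ (next i) = step i
    adj-↝ wrap     = close

    cycleEdge-↝ : ∀ {i j u w} → i ↝ j → SamePair G (x i) (x j) u w → CycleEdge G C u w
    cycleEdge-↝ (next i) same = inj₁ (i , same)
    cycleEdge-↝ wrap     same = inj₂ same

    rebase : Rotation k → Cycle G
    rebase ρ = record
      { k     = k
      ; len   = len
      ; x     = x ∘ rotate ρ
      ; inj   = injective ρ ∘ inj
      ; step  = λ i → adj-↝ (preserves-↝ ρ (next i))
      ; close = adj-↝ (preserves-↝ ρ wrap)
      }

    rebase-part : ∀ ρ s → PartOf (rebase ρ) s → PartOf C s
    rebase-part ρ (inj₁ v) (i , eq)          = rotate ρ i , eq
    rebase-part ρ (inj₂ e) (inj₁ (i , same)) = cycleEdge-↝ (preserves-↝ ρ (next i)) same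
    rebase-part ρ (inj₂ e) (inj₂ same)       = cycleEdge-↝ (preserves-↝ ρ wrap) same

    rebaseAt : ∀ {w} → OnCycle G C w →
      Σ[ D ∈ Cycle G ] Cycle.x D zero ≡ w × (∀ s → PartOf D s → PartOf C s)
    rebaseAt (i , xi≡w) with rotationTo i
    ... | ρ , ρ0≡i = rebase ρ , trans (cong x ρ0≡i) xi≡w , rebase-part ρ

  record Walk (m : ℕ) : Set where
    field
      vertex : Fin (suc m) → Fin n
      end    : Fin n
      steps  : ∀ i → adj (vertex (inject₁ i)) (vertex (suc i)) ≡ true
      last   : adj (vertex (fromℕ m)) end ≡ true

  open Walk

  WalkEdge : ∀ {m} → Walk m → Fin n → Fin n → Set
  WalkEdge {m} W u w = (∃[ i ] SamePair G (vertex W (inject₁ i)) (vertex W (suc i)) u w)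
                     ⊎ SamePair G (vertex W (fromℕ m)) (end W) u w

  -- CycleEdge G C is WalkEdge (cycleWalk C) by definition.
  cycleWalk : (C : Cycle G) → Walk (Cycle.k C)
  cycleWalk C = record
    { vertex = Cycle.x C ; end = Cycle.x C zero ; steps = Cycle.step C ; last = Cycle.close C }

  dropFirst : ∀ {m} → Walk (suc m) → Walk m
  dropFirst W = record
    { vertex = vertex W ∘ suc ; end = end W ; steps = steps W ∘ suc ; last = last W }

  rungs : ∀ {m} → Walk m → List SV
  rungs {zero}  W = [ inj₂ (edgeBetween _ _ (last W)) ]
  rungs {suc m} W =
    inj₁ (vertex W (suc zero)) ∷ inj₂ (edgeBetween _ _ (steps W zero)) ∷ rungs (dropFirst W)

  walk-ladder : ∀ {m} (W : Walk m) → Ladder (S G) (inj₁ (vertex W zero)) (inj₁ (end W)) (rungs W)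
  walk-ladder {zero}  W = top (edgeBetween-joins _ _ _)
  walk-ladder {suc m} W = rung (edgeBetween-joins _ _ _) (walk-ladder (dropFirst W))

  rungs-vertex : ∀ {m v} (W : Walk m) → inj₁ v ∈ rungs W → ∃[ i ] vertex W (suc i) ≡ v
  rungs-vertex {zero}  W (here ())
  rungs-vertex {zero}  W (there ())
  rungs-vertex {suc m} W (here refl)         = zero , refl
  rungs-vertex {suc m} W (there (here ()))
  rungs-vertex {suc m} W (there (there mem)) with rungs-vertex (dropFirst W) mem
  ... | i , eq = suc i , eq

  rungs-edge : ∀ {m e} (W : Walk m) → inj₂ e ∈ rungs W → WalkEdge W (endˡ e) (endʳ e)
  rungs-edge {zero}  W (here refl)         = inj₂ (edgeBetween-ends _ _ _)
  rungs-edge {suc m} W (there (here refl)) = inj₁ (zero , edgeBetween-ends _ _ _)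
  rungs-edge {suc m} W (there (there mem)) with rungs-edge (dropFirst W) mem
  ... | inj₁ (i , same) = inj₁ (suc i , same)
  ... | inj₂ same       = inj₂ same

  -- The last hypothesis excludes a closed walk of length one, whose only two rungs would be
  -- the same edge.
  rungs-unique : ∀ {m} (W : Walk m) → Injective _≡_ _≡_ (vertex W) →
    (∀ i → vertex W (suc i) ≢ end W) → (vertex W zero ≡ end W → 2 ≤ m) → Unique (rungs W)
  rungs-unique {zero}  W _ _ _ = [] ∷ []
  rungs-unique {suc m} W inj later≢end closed =
    ¬Any⇒All¬ _ second∉ ∷ ¬Any⇒All¬ _ first-edge∉ ∷
    rungs-unique (dropFirst W) (suc-injective ∘ inj) (later≢end ∘ suc) (⊥-elim ∘ later≢end zero)
    where
      first-ends = edgeBetween-ends _ _ (steps W zero)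

      second∉ : inj₁ (vertex W (suc zero)) ∉
                inj₂ (edgeBetween _ _ (steps W zero)) ∷ rungs (dropFirst W)
      second∉ (here ())
      second∉ (there mem) with rungs-vertex (dropFirst W) mem
      ... | _ , eq with () ← inj eq

      first-edge∉ : inj₂ (edgeBetween _ _ (steps W zero)) ∉ rungs (dropFirst W)
      first-edge∉ mem with rungs-edge (dropFirst W) mem
      ... | inj₁ (_ , same) with samePair-euclid first-ends same
      ...   | inj₁ (eq , _) with () ← inj eq
      ...   | inj₂ (eq , _) with () ← inj eq
      first-edge∉ mem | inj₂ same with samePair-euclid first-ends same
      ...   | inj₁ (eq , _) with () ← inj eq
      ...   | inj₂ (start≡end , eq) = too-short m (closed start≡end) (inj eq)
        where
          too-short : ∀ m → 2 ≤ suc m → Fin.suc {suc m} zero ≢ suc (fromℕ m)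
          too-short zero    (s≤s ()) _
          too-short (suc m) _        ()

  bob-wins-around-cycle : ∀ {m w} {p : Partial (S G) (suc (suc m))} (C : Cycle G) →
    OnCycle G C w → p (inj₁ w) ≡ just zero →
    (∀ s → PartOf C s → s ≢ inj₁ w → p s ≡ nothing) → ¬ AliceWinsFrom (S G) p bob
  bob-wins-around-cycle {p = p} C onC pw untouched with rebaseAt C onC
  ... | D , refl , D⊆C =
    ladder⇒bob-wins {p = p} (walk-ladder W) pw pw (All.tabulate uncoloured)
      (rungs-unique W (Cycle.inj D) later≢start (λ _ → Cycle.len D))
    where
      W = cycleWalk D

      later≢start : ∀ i → Cycle.x D (suc i) ≢ Cycle.x D zero
      later≢start i eq with () ← Cycle.inj D eq

      uncoloured : ∀ {s} → s ∈ rungs W → p s ≡ nothing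
      uncoloured {inj₁ v} mem with rungs-vertex W mem
      ... | i , refl = untouched _ (D⊆C _ (suc i , refl)) (λ eq → later≢start i (inj₁-injective eq))
      uncoloured {inj₂ e} mem = untouched (inj₂ e) (D⊆C (inj₂ e) (rungs-edge W mem)) λ ()

  bob-wins-on-figure-eight : ∀ {m} {p : Partial (S G) (suc (suc m))} (C D : Cycle G) →
    EdgeDisjoint G C D → ShareExactlyOneVertex G C D →
    (∀ s → PartOf C s ⊎ PartOf D s → p s ≡ nothing) → ¬ AliceWinsFrom (S G) p bob
  bob-wins-on-figure-eight {p = p} C D disjoint (w , (onC , onD) , shared) untouched =
    bob-wins-by-move (S G) (inj₁ w) zero (untouched _ (inj₁ onC))
      (alice-loses-if-every-move-loses (S G) (inj₂ (closingEdge C) , p₁-closing) reply)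
    where
      p₁ = update (S G) p (inj₁ w) zero
      p₁w : p₁ (inj₁ w) ≡ just zero
      p₁w = update-≡ (S G) p (inj₁ w) zero
      p₁-closing : p₁ (inj₂ (closingEdge C)) ≡ nothing
      p₁-closing = update-keeps-uncoloured (S G) {v = inj₁ w} p zero (λ ())
                     (untouched _ (inj₁ (closingEdge-part C)))

      around : ∀ z col → p₁ z ≡ nothing → (E : Cycle G) → OnCycle G E w →
        (∀ {s} → PartOf E s → PartOf C s ⊎ PartOf D s) → ¬ PartOf E z →
        ¬ AliceWinsFrom (S G) (update (S G) p₁ z col) bob
      around z col p₁z E onE E⊆C∪D z∉E =
        bob-wins-around-cycle E onE (update-keeps-colour (S G) p₁ p₁z p₁w) λ s s∈E s≢w →
          update-keeps-uncoloured (S G) {v = z} p₁ col (λ { refl → z∉E s∈E })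
            (update-keeps-uncoloured (S G) p zero s≢w (untouched s (E⊆C∪D s∈E)))

      reply : ∀ z col → p₁ z ≡ nothing → ¬ AliceWinsFrom (S G) (update (S G) p₁ z col) bob
      reply z col p₁z with partOf? C z
      ... | no  z∉C = around z col p₁z C onC inj₁ z∉C
      ... | yes z∈C = around z col p₁z D onD inj₂ λ z∈D →
              coloured≢uncoloured (S G) p₁ p₁w p₁z (sym (common-part disjoint shared z∈C z∈D))

  first-move-misses : ∀ {k} (C D : Cycle G) z (col : Fin k) →
    ¬ (OnCycle G C (anchor z) ⊎ OnCycle G D (anchor z)) →
    ∀ s → PartOf C s ⊎ PartOf D s → update (S G) (λ _ → nothing) z col s ≡ nothing
  first-move-misses C D z col off s s∈C∪D =
    update-keeps-uncoloured (S G) {y = s} {v = z} (λ _ → nothing) col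
      (λ { refl → off (Sum.map (part⇒anchor-onCycle C s) (part⇒anchor-onCycle D s) s∈C∪D) }) refl

lemma5p8 : (G : SimpleGraph) (F₁ F₂ F₃ F₄ : Cycle G) →
    EdgeDisjoint G F₁ F₂ → EdgeDisjoint G F₁ F₃ → EdgeDisjoint G F₁ F₄ →
    EdgeDisjoint G F₂ F₃ → EdgeDisjoint G F₂ F₄ → EdgeDisjoint G F₃ F₄ →
    ShareExactlyOneVertex G F₁ F₂ → ShareExactlyOneVertex G F₃ F₄ →
    (∀ (v : Fin (SimpleGraph.n G)) → (OnCycle G F₁ v ⊎ OnCycle G F₂ v) →
    ¬ (OnCycle G F₃ v ⊎ OnCycle G F₄ v)) →
    GameDomaticNumberIs (S G) 1
lemma5p8 G F₁ F₂ F₃ F₄ d₁₂ _ _ _ _ d₃₄ s₁₂ s₃₄ apart =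
  alice-wins-with-one-colour , bob-wins
  where
    open Strategies (S G) (subdivisionVertices G) (∈-subdivisionVertices G)

    bob-wins : ∀ k → 1 < k → ¬ AliceWinsAGame (S G) k
    bob-wins (suc zero) (s≤s ())
    bob-wins (suc (suc m)) _ =
      alice-loses-if-every-move-loses (S G) (inj₁ (Cycle.x F₁ zero) , refl) λ z col _ → reply z col
      where
        reply : ∀ z col → ¬ AliceWinsFrom (S G) (update (S G) (λ _ → nothing) z col) bob
        reply z col with onCycle? G F₁ (anchor G z) ⊎-dec onCycle? G F₂ (anchor G z)
        ... | yes on₁₂ = bob-wins-on-figure-eight G F₃ F₄ d₃₄ s₃₄
                           (first-move-misses G F₃ F₄ z col (apart _ on₁₂))
        ... | no off₁₂ = bob-wins-on-figure-eight G F₁ F₂ d₁₂ s₁₂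
                           (first-move-misses G F₁ F₂ z col off₁₂)
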